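{- If $B\ge\mathrm{opt}$, then $\mathrm{OPT}_B\le\mathrm{opt}\le B$.
   Context: $\ell$-centrum problem: finite metric space $(\mathcal D,\{c_{ij}\})$ with $n=|\mathcal D|>k$, integers $k\ge0$ and $\ell\in\{1,\dots,n\}$; choose $k$ centers in $\mathcal D$ and assign each client to a center to minimize the sum of the $\ell$ largest assignment costs; $\mathrm{opt}$ is the optimal value. For $B\ge0$, $f_B(d)=d$ if $d>B/\ell$, else $0$. $\mathrm{OPT}_B$ is the optimal value of the LP: minimize $\sum_j\sum_if_B(c_{ij})x_{ij}$ s.t. $\sum_ix_{ij}\ge1$ $\forall j$, $0\le x_{ij}\le y_i$ $\forall i,j$, $\sum_iy_i\le k$ (indices over $\mathcal D$).
   Formalization: The distances $c_{ij}$ and the bound $B$ are rational, and the LP variables $x_{ij}$ and $y_i$ are taken in the rationals. -}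

module Defs where

open import Data.Nat as ℕ using (ℕ)
open import Data.Integer using (+_)
open import Data.Rational using (ℚ; 0ℚ; 1ℚ; _+_; _*_; _/_; _≤_; _<_; _<?_)
open import Data.Rational.Properties using (≤-decTotalOrder)
open import Data.Fin using (Fin)
open import Data.Fin.Subset using (Subset; _∈_)
open import Data.List using (List; foldr; map; allFin; take; reverse)
open import Data.List.Sort ≤-decTotalOrder using (sort)
open import Relation.Nullary using (yes; no)
open import Relation.Binary.PropositionalEquality using (_≡_)

sumℚ : List ℚ → ℚ
sumℚ = foldr _+_ 0ℚ

Σ[_]_ : (n : ℕ) → (Fin n → ℚ) → ℚ
Σ[ n ] f = sumℚ (map f (allFin n))

record IsMetric (n : ℕ) (c : Fin n → Fin n → ℚ) : Set where
  field
    nonneg   : ∀ i j → 0ℚ ≤ c i j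
    zero-iff : ∀ i j → (c i j ≡ 0ℚ → i ≡ j) 
    refl0    : ∀ i → c i i ≡ 0ℚ
    sym      : ∀ i j → c i j ≡ c j i
    triangle : ∀ i j m → c i m ≤ c i j + c j m

topSum : ℕ → List ℚ → ℚ
topSum ℓ xs = sumℚ (take ℓ (reverse (sort xs)))

record Solution (n k : ℕ) : Set where
  field
    centres  : Subset n
    card     : Data.Fin.Subset.∣ centres ∣ ≡ k
    assign   : Fin n → Fin n
    assign∈  : ∀ j → assign j ∈ centres

cost : {n k : ℕ} → (Fin n → Fin n → ℚ) → ℕ → Solution n k → ℚ
cost {n} c ℓ s = topSum ℓ (map (λ j → c (Solution.assign s j) j) (allFin n))

IsOptimal : {n k : ℕ} → (Fin n → Fin n → ℚ) → ℕ → Solution n k → Set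
IsOptimal {n} {k} c ℓ s = ∀ (t : Solution n k) → cost c ℓ s ≤ cost c ℓ t

fB : (B : ℚ) (ℓ : ℕ) .{{_ : ℕ.NonZero ℓ}} → ℚ → ℚ
fB B ℓ d with B * ((+ 1) / ℓ) <? d
... | yes _ = d
... | no _  = 0ℚ

-- feasible LP solutions (x i j : client j assigned to facility i)
record LPFeasible (n k : ℕ) (x : Fin n → Fin n → ℚ) (y : Fin n → ℚ) : Set where
  field
    cover  : ∀ j → 1ℚ ≤ Σ[ n ] (λ i → x i j)
    x≥0    : ∀ i j → 0ℚ ≤ x i j
    x≤y    : ∀ i j → x i j ≤ y i
    budget : Σ[ n ] y ≤ (+ k) / 1


LPValue : (n : ℕ) (c : Fin n → Fin n → ℚ) (B : ℚ) (ℓ : ℕ) .{{_ : ℕ.NonZero ℓ}}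
        → (Fin n → Fin n → ℚ) → ℚ
LPValue n c B ℓ x = Σ[ n ] (λ j → Σ[ n ] (λ i → fB B ℓ (c i j) * x i j))

-- The ℓ-centrum cost of an optimal solution is the sum of its ℓ largest
-- assignment costs, and it is at most B.  Hence every assignment cost outside
-- the top ℓ is at most B/ℓ: otherwise all ℓ top costs would exceed B/ℓ and
-- their sum would exceed B.  So f_B vanishes outside the top ℓ, and as
-- f_B(d) ≤ d the f_B-cost of the optimal assignment is at most opt.  That is
-- the LP value of the integral solution x_ij = [i = σ(j)], y = [i ∈ S].
module Submission where

open import Defs
open import Data.Nat as ℕ using (ℕ; suc)
open import Data.Fin using (Fin)
open import Data.Rational using (ℚ; 0ℚ; _≤_)
open import Data.Product using (_×_; ∃₂)

open import Data.Bool using (Bool; true; false)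
open import Data.Integer as ℤ using (+_)
import Data.Integer.Properties as ℤP
import Data.Nat.Properties as ℕP
open import Data.Rational using (1ℚ; _<_; _+_; _*_; _/_; _<?_; toℚᵘ)
open import Data.Rational.Properties
  using ( ≤-decTotalOrder; ≤-refl; ≤-reflexive; ≤-trans; <⇒≤; <-≤-trans; <-irrefl
        ; +-mono-≤; +-mono-<-≤; +-identityˡ; +-identityʳ; nonNegative⁻¹; +-0-isCommutativeMonoid
        ; *-comm; *-assoc; *-identityˡ; *-identityʳ; *-zeroˡ; *-zeroʳ; *-distribʳ-+
        ; module ≤-Reasoning; toℚᵘ-injective; toℚᵘ-fromℚᵘ; toℚᵘ-homo-+; toℚᵘ-homo-* )
import Data.Rational.Unnormalised as ℚᵘ
import Data.Rational.Unnormalised.Properties as ℚᵘP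
open import Data.Product using (_,_)
open import Data.List using (List; []; _∷_; _++_; foldr; map; take; drop; reverse; replicate; length; allFin)
import Data.List.Properties as List
open import Data.List.Relation.Unary.All as All using (All; []; _∷_)
import Data.List.Relation.Unary.All.Properties as All
open import Data.List.Relation.Unary.AllPairs using (AllPairs; []; _∷_)
import Data.List.Relation.Unary.AllPairs.Properties as AllPairs
import Data.List.Relation.Unary.Linked.Properties as Linked
open import Data.List.Membership.Propositional using (_∈_)
open import Data.List.Relation.Binary.Permutation.Propositional using (_↭_; ↭-sym; ↭-trans; ↭⇒↭ₛ)
open import Data.List.Relation.Binary.Permutation.Propositional.Properties using (map⁺; ↭-reverse; All-resp-↭)
open import Data.List.Relation.Binary.Permutation.Setoid.Properties using (foldr-commMonoid)
open import Data.List.Sort ≤-decTotalOrder using (sort; sort-↭; sort-↗)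
open import Data.Vec using (lookup) renaming ([] to []ᵥ; _∷_ to _∷ᵥ_)
open import Data.Vec.Properties using ([]=⇒lookup)
import Data.Fin as Fin
import Data.Fin.Properties as Fin
open import Data.Fin.Subset as Subset using (Subset)
open import Function using (flip; id; _∘_)
open import Relation.Nullary using (¬_; does; yes; no)
open import Data.Empty using (⊥-elim)
open import Relation.Nullary.Decidable using (dec-true; dec-false)
open import Relation.Binary.PropositionalEquality
  using (_≡_; _≢_; refl; sym; trans; cong; cong₂; setoid; module ≡-Reasoning)

+suc/1 : ∀ m → + suc m / 1 ≡ 1ℚ + + m / 1
+suc/1 m = toℚᵘ-injective (begin
  toℚᵘ (+ suc m / 1)                ≈⟨ toℚᵘ-fromℚᵘ (ℚᵘ.mkℚᵘ (+ suc m) 0) ⟩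
  ℚᵘ.mkℚᵘ (+ suc m) 0               ≈⟨ suc≃1+ ⟩
  ℚᵘ.1ℚᵘ ℚᵘ.+ ℚᵘ.mkℚᵘ (+ m) 0       ≈⟨ ℚᵘP.+-congʳ ℚᵘ.1ℚᵘ (toℚᵘ-fromℚᵘ (ℚᵘ.mkℚᵘ (+ m) 0)) ⟨
  ℚᵘ.1ℚᵘ ℚᵘ.+ toℚᵘ (+ m / 1)        ≈⟨ toℚᵘ-homo-+ 1ℚ (+ m / 1) ⟨
  toℚᵘ (1ℚ + + m / 1)               ∎)
  where
  open ℚᵘP.≃-Reasoning
  suc≃1+ : ℚᵘ.mkℚᵘ (+ suc m) 0 ℚᵘ.≃ ℚᵘ.1ℚᵘ ℚᵘ.+ ℚᵘ.mkℚᵘ (+ m) 0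
  suc≃1+ = ℚᵘ.*≡* (trans (ℤP.*-identityʳ (+ suc m))
                    (sym (trans (ℤP.*-identityʳ (ℤ._+_ (+ 1) (+ m ℤ.* + 1)))
                      (cong (ℤ._+_ (+ 1)) (ℤP.*-identityʳ (+ m))))))

ℓ*1/ℓ≡1 : ∀ ℓ .{{_ : ℕ.NonZero ℓ}} → + ℓ / 1 * (+ 1 / ℓ) ≡ 1ℚ
ℓ*1/ℓ≡1 (suc m) = toℚᵘ-injective (begin
  toℚᵘ (+ suc m / 1 * (+ 1 / suc m))                  ≈⟨ toℚᵘ-homo-* (+ suc m / 1) (+ 1 / suc m) ⟩
  toℚᵘ (+ suc m / 1) ℚᵘ.* toℚᵘ (+ 1 / suc m)          ≈⟨ ℚᵘP.*-cong (toℚᵘ-fromℚᵘ (ℚᵘ.mkℚᵘ (+ suc m) 0)) (toℚᵘ-fromℚᵘ (ℚᵘ.mkℚᵘ (+ 1) m)) ⟩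
  ℚᵘ.mkℚᵘ (+ suc m) 0 ℚᵘ.* ℚᵘ.mkℚᵘ (+ 1) m            ≈⟨ ℚᵘ.*≡* (cong (λ k → + suc k) m*1*1≡m+0+0) ⟩
  ℚᵘ.1ℚᵘ                                              ∎)
  where
  open ℚᵘP.≃-Reasoning
  m*1*1≡m+0+0 : m ℕ.* 1 ℕ.* 1 ≡ m ℕ.+ 0 ℕ.+ 0
  m*1*1≡m+0+0 = trans (trans (ℕP.*-identityʳ _) (ℕP.*-identityʳ m))
                      (sym (trans (ℕP.+-identityʳ _) (ℕP.+-identityʳ m)))

sumℚ-replicate : ∀ m q → sumℚ (replicate m q) ≡ + m / 1 * q
sumℚ-replicate ℕ.zero    q = sym (*-zeroˡ q)
sumℚ-replicate (suc m) q = begin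
  q + sumℚ (replicate m q)      ≡⟨ cong₂ _+_ (sym (*-identityˡ q)) (sumℚ-replicate m q) ⟩
  1ℚ * q + + m / 1 * q          ≡⟨ *-distribʳ-+ q 1ℚ (+ m / 1) ⟨
  (1ℚ + + m / 1) * q            ≡⟨ cong (_* q) (+suc/1 m) ⟨
  + suc m / 1 * q               ∎
  where open ≡-Reasoning

sumℚ-replicate-B/ℓ : ∀ ℓ .{{_ : ℕ.NonZero ℓ}} B → sumℚ (replicate ℓ (B * (+ 1 / ℓ))) ≡ B
sumℚ-replicate-B/ℓ ℓ B = begin
  sumℚ (replicate ℓ (B * (+ 1 / ℓ)))    ≡⟨ sumℚ-replicate ℓ _ ⟩
  + ℓ / 1 * (B * (+ 1 / ℓ))             ≡⟨ cong (+ ℓ / 1 *_) (*-comm B _) ⟩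
  + ℓ / 1 * (+ 1 / ℓ * B)               ≡⟨ *-assoc (+ ℓ / 1) _ B ⟨
  + ℓ / 1 * (+ 1 / ℓ) * B               ≡⟨ cong (_* B) (ℓ*1/ℓ≡1 ℓ) ⟩
  1ℚ * B                                ≡⟨ *-identityˡ B ⟩
  B                                     ∎
  where open ≡-Reasoning

sumℚ-↭ : ∀ {xs ys} → xs ↭ ys → sumℚ xs ≡ sumℚ ys
sumℚ-↭ p = foldr-commMonoid (setoid ℚ) +-0-isCommutativeMonoid (↭⇒↭ₛ p)

sumℚ-replicate-≤ : ∀ {t} {ys : List ℚ} → All (t ≤_) ys → sumℚ (replicate (length ys) t) ≤ sumℚ ys
sumℚ-replicate-≤ []       = ≤-refl
sumℚ-replicate-≤ (p ∷ ps) = +-mono-≤ p (sumℚ-replicate-≤ ps)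

sumℚ-replicate-< : ∀ {t ℓ} .{{_ : ℕ.NonZero ℓ}} {ys : List ℚ} → All (t <_) ys → length ys ≡ ℓ
                 → sumℚ (replicate ℓ t) < sumℚ ys
sumℚ-replicate-< (p ∷ ps) refl = +-mono-<-≤ p (sumℚ-replicate-≤ (All.map <⇒≤ ps))

AllPairs-reverse⁺ : ∀ {A : Set} {R : A → A → Set} {xs : List A}
                  → AllPairs R xs → AllPairs (flip R) (reverse xs)
AllPairs-reverse⁺ [] = []
AllPairs-reverse⁺ {xs = x ∷ xs} (px ∷ pxs) rewrite List.unfold-reverse x xs =
  AllPairs.++⁺ (AllPairs-reverse⁺ pxs) ([] ∷ [])
    (All.map (_∷ []) (All-resp-↭ (↭-sym (↭-reverse xs)) px))

AllPairs⇒take-drop : ∀ {A : Set} {R : A → A → Set} {xs : List A} n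
                   → AllPairs R xs → All (λ a → All (R a) (drop n xs)) (take n xs)
AllPairs⇒take-drop ℕ.zero    _          = []
AllPairs⇒take-drop (suc n) []         = []
AllPairs⇒take-drop (suc n) (px ∷ pxs) = All.drop⁺ n px ∷ AllPairs⇒take-drop n pxs

length-take-∈drop : ∀ {A : Set} {y : A} n (xs : List A) → y ∈ drop n xs → length (take n xs) ≡ n
length-take-∈drop ℕ.zero    xs       _   = refl
length-take-∈drop (suc n) (x ∷ xs) y∈ = cong suc (length-take-∈drop n xs y∈)

descending : List ℚ → List ℚ
descending xs = reverse (sort xs)

descending-↭ : ∀ xs → descending xs ↭ xs
descending-↭ xs = ↭-trans (↭-reverse (sort xs)) (sort-↭ xs)

descending-sorted : ∀ xs → AllPairs (flip _≤_) (descending xs)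
descending-sorted xs = AllPairs-reverse⁺ (Linked.Linked⇒AllPairs ≤-trans (sort-↗ xs))

fB-≤ : ∀ B ℓ .{{_ : ℕ.NonZero ℓ}} {d} → 0ℚ ≤ d → fB B ℓ d ≤ d
fB-≤ B ℓ {d} 0≤d with B * (+ 1 / ℓ) <? d
... | yes _ = ≤-refl
... | no _  = 0≤d

fB-below : ∀ B ℓ .{{_ : ℕ.NonZero ℓ}} {d} → ¬ (B * (+ 1 / ℓ) < d) → fB B ℓ d ≡ 0ℚ
fB-below B ℓ {d} d≯t with B * (+ 1 / ℓ) <? d
... | yes t<d = ⊥-elim (d≯t t<d)
... | no _    = refl

sumℚ-map-≤ : ∀ {f : ℚ → ℚ} {xs} → All (λ x → f x ≤ x) xs → sumℚ (map f xs) ≤ sumℚ xs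
sumℚ-map-≤ []       = ≤-refl
sumℚ-map-≤ (p ∷ ps) = +-mono-≤ p (sumℚ-map-≤ ps)

sumℚ-map-≡0 : ∀ {A : Set} {f : A → ℚ} {xs} → All (λ x → f x ≡ 0ℚ) xs → sumℚ (map f xs) ≡ 0ℚ
sumℚ-map-≡0 []       = refl
sumℚ-map-≡0 (p ∷ ps) = trans (cong₂ _+_ p (sumℚ-map-≡0 ps)) (+-identityʳ 0ℚ)

outside-top-≯B/ℓ : ∀ B ℓ .{{_ : ℕ.NonZero ℓ}} xs → topSum ℓ xs ≤ B
                 → All (λ d → ¬ (B * (+ 1 / ℓ) < d)) (drop ℓ (descending xs))
outside-top-≯B/ℓ B ℓ xs top≤B = All.tabulate λ {d} d∈ t<d → <-irrefl refl (begin-strict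
  B                                   ≡⟨ sumℚ-replicate-B/ℓ ℓ B ⟨
  sumℚ (replicate ℓ (B * (+ 1 / ℓ)))  <⟨ sumℚ-replicate-< (top-above d∈ t<d) (length-take-∈drop ℓ zs d∈) ⟩
  topSum ℓ xs                         ≤⟨ top≤B ⟩
  B                                   ∎)
  where
  open ≤-Reasoning
  zs = descending xs
  top-above : ∀ {d} → d ∈ drop ℓ zs → B * (+ 1 / ℓ) < d → All (B * (+ 1 / ℓ) <_) (take ℓ zs)
  top-above d∈ t<d = All.map (λ a≥D → <-≤-trans t<d (All.lookup a≥D d∈))
                             (AllPairs⇒take-drop ℓ (descending-sorted xs))

sumℚ-fB-≤-topSum : ∀ B ℓ .{{_ : ℕ.NonZero ℓ}} xs → All (0ℚ ≤_) xs → topSum ℓ xs ≤ B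
                 → sumℚ (map (fB B ℓ) xs) ≤ topSum ℓ xs
sumℚ-fB-≤-topSum B ℓ xs 0≤xs top≤B = begin
  sumℚ (map F xs)                        ≡⟨ sumℚ-↭ (map⁺ F (descending-↭ xs)) ⟨
  sumℚ (map F zs)                        ≡⟨ cong (λ ws → sumℚ (map F ws)) (List.take++drop≡id ℓ zs) ⟨
  sumℚ (map F (take ℓ zs ++ drop ℓ zs))  ≡⟨ cong sumℚ (List.map-++ F (take ℓ zs) (drop ℓ zs)) ⟩
  sumℚ (map F (take ℓ zs) ++ map F (drop ℓ zs))
                                         ≡⟨ List.foldr-++ _+_ 0ℚ (map F (take ℓ zs)) (map F (drop ℓ zs)) ⟩
  foldr _+_ (sumℚ (map F (drop ℓ zs))) (map F (take ℓ zs))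
                                         ≡⟨ cong (λ z → foldr _+_ z (map F (take ℓ zs))) outside≡0 ⟩
  sumℚ (map F (take ℓ zs))               ≤⟨ sumℚ-map-≤ (All.map (fB-≤ B ℓ) (All.take⁺ ℓ 0≤zs)) ⟩
  topSum ℓ xs                            ∎
  where
  open ≤-Reasoning
  F = fB B ℓ
  zs = descending xs
  0≤zs : All (0ℚ ≤_) zs
  0≤zs = All-resp-↭ (↭-sym (descending-↭ xs)) 0≤xs
  outside≡0 : sumℚ (map F (drop ℓ zs)) ≡ 0ℚ
  outside≡0 = sumℚ-map-≡0 (All.map (fB-below B ℓ) (outside-top-≯B/ℓ B ℓ xs top≤B))

Σ-suc : ∀ n (f : Fin (suc n) → ℚ) → Σ[ suc n ] f ≡ f Fin.zero + Σ[ n ] (λ i → f (Fin.suc i))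
Σ-suc n f = cong (_+_ (f Fin.zero))
  (trans (cong sumℚ (List.map-tabulate Fin.suc f)) (sym (cong sumℚ (List.map-tabulate id (f ∘ Fin.suc)))))

Σ-zero : ∀ n {f : Fin n → ℚ} → (∀ i → f i ≡ 0ℚ) → Σ[ n ] f ≡ 0ℚ
Σ-zero n f≡0 = sumℚ-map-≡0 (All.universal f≡0 (allFin n))

Σ-concentrated : ∀ n {f : Fin n → ℚ} (a : Fin n) → (∀ i → i ≢ a → f i ≡ 0ℚ) → Σ[ n ] f ≡ f a
Σ-concentrated (suc n) {f} Fin.zero f≡0 = begin
  Σ[ suc n ] f                                     ≡⟨ Σ-suc n f ⟩
  f Fin.zero + Σ[ n ] (λ i → f (Fin.suc i))        ≡⟨ cong (_+_ (f Fin.zero)) (Σ-zero n (λ i → f≡0 (Fin.suc i) λ ())) ⟩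
  f Fin.zero + 0ℚ                                  ≡⟨ +-identityʳ (f Fin.zero) ⟩
  f Fin.zero                                       ∎
  where open ≡-Reasoning
Σ-concentrated (suc n) {f} (Fin.suc a) f≡0 = begin
  Σ[ suc n ] f                                     ≡⟨ Σ-suc n f ⟩
  f Fin.zero + Σ[ n ] (λ i → f (Fin.suc i))        ≡⟨ cong₂ _+_ (f≡0 Fin.zero λ ())
                                                        (Σ-concentrated n a λ i i≢a → f≡0 (Fin.suc i) (i≢a ∘ Fin.suc-injective)) ⟩
  0ℚ + f (Fin.suc a)                               ≡⟨ +-identityˡ _ ⟩
  f (Fin.suc a)                                    ∎
  where open ≡-Reasoning

indicator : Bool → ℚ
indicator true  = 1ℚ
indicator false = 0ℚ

0≤indicator : ∀ b → 0ℚ ≤ indicator b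
0≤indicator true  = nonNegative⁻¹ 1ℚ
0≤indicator false = ≤-refl

Σ-indicator : ∀ n (S : Subset n) → Σ[ n ] (λ i → indicator (lookup S i)) ≡ + Subset.∣ S ∣ / 1
Σ-indicator ℕ.zero  []ᵥ          = refl
Σ-indicator (suc n) (true ∷ᵥ S)  = trans (Σ-suc n (λ i → indicator (lookup (true ∷ᵥ S) i)))
  (trans (cong (_+_ 1ℚ) (Σ-indicator n S)) (sym (+suc/1 Subset.∣ S ∣)))
Σ-indicator (suc n) (false ∷ᵥ S) = trans (Σ-suc n (λ i → indicator (lookup (false ∷ᵥ S) i)))
  (trans (+-identityˡ _) (Σ-indicator n S))

δ : ∀ {n} → Fin n → Fin n → ℚ
δ a i = indicator (does (i Fin.≟ a))

δ-diag : ∀ {n} (a : Fin n) → δ a a ≡ 1ℚ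
δ-diag a = cong indicator (dec-true (a Fin.≟ a) refl)

δ-off-diag : ∀ {n} {a i : Fin n} → i ≢ a → δ a i ≡ 0ℚ
δ-off-diag {a = a} {i} i≢a = cong indicator (dec-false (i Fin.≟ a) i≢a)

δ-≤-indicator : ∀ {n} {S : Subset n} {a} i → lookup S a ≡ true → δ a i ≤ indicator (lookup S i)
δ-≤-indicator {S = S} {a} i a∈S with i Fin.≟ a
... | yes refl rewrite a∈S = ≤-refl
... | no _                 = 0≤indicator (lookup S i)

Σ-δ : ∀ n (a : Fin n) (f : Fin n → ℚ) → Σ[ n ] (λ i → f i * δ a i) ≡ f a
Σ-δ n a f = trans (Σ-concentrated n a λ i i≢a → trans (cong (f i *_) (δ-off-diag i≢a)) (*-zeroʳ (f i)))
                  (trans (cong (f a *_) (δ-diag a)) (*-identityʳ (f a)))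

module Integral {n k : ℕ} (s : Solution n k) where
  open Solution s

  x : Fin n → Fin n → ℚ
  x i j = δ (assign j) i

  y : Fin n → ℚ
  y i = indicator (lookup centres i)

  feasible : LPFeasible n k x y
  feasible = record
    { cover  = λ j → ≤-reflexive (sym (trans (Σ-concentrated n (assign j) λ i → δ-off-diag) (δ-diag (assign j))))
    ; x≥0    = λ i j → 0≤indicator (does (i Fin.≟ assign j))
    ; x≤y    = λ i j → δ-≤-indicator {S = centres} i ([]=⇒lookup (assign∈ j))
    ; budget = ≤-reflexive (trans (Σ-indicator n centres) (cong (λ m → + m / 1) card))
    }

  value : ∀ c B ℓ .{{_ : ℕ.NonZero ℓ}}
        → LPValue n c B ℓ x ≡ sumℚ (map (fB B ℓ) (map (λ j → c (assign j) j) (allFin n)))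
  value c B ℓ = trans (cong sumℚ (List.map-cong (λ j → Σ-δ n (assign j) (λ i → fB B ℓ (c i j))) (allFin n)))
                      (cong sumℚ (List.map-∘ (allFin n)))

claim1 : (n k ℓ : ℕ) → .{{_ : ℕ.NonZero ℓ}} → ℓ ℕ.≤ n → k ℕ.< n
       → (c : Fin n → Fin n → ℚ) → IsMetric n c
       → (s : Solution n k) → IsOptimal c ℓ s
       → (B : ℚ) → 0ℚ ≤ B → cost c ℓ s ≤ B
       → (∃₂ λ (x : Fin n → Fin n → ℚ) (y : Fin n → ℚ) →
            LPFeasible n k x y × LPValue n c B ℓ x ≤ cost c ℓ s)
         × cost c ℓ s ≤ B
claim1 n k ℓ _ _ c metric s _ B _ cost≤B = (x , y , feasible , value≤cost) , cost≤B
  where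
  open Integral s
  costs : List ℚ
  costs = map (λ j → c (Solution.assign s j) j) (allFin n)
  value≤cost : LPValue n c B ℓ x ≤ cost c ℓ s
  value≤cost = ≤-trans (≤-reflexive (value c B ℓ))
    (sumℚ-fB-≤-topSum B ℓ costs (All.map⁺ (All.universal (λ j → IsMetric.nonneg metric _ j) (allFin n))) cost≤B)
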